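{- Every single-coalition-first action model is $z$-representable by a single-coalition-first neighborhood model.
   Context: $AG$ is a finite nonempty set of agents, $AP$ a countable set of atomic propositions. For a nonempty set $AC$ and $C\subseteq AG$, $JA_C$ is the set of functions $\sigma_C:C\to AC$ ($JA_\emptyset=\{\emptyset\}$); $\sigma_C|_{\{a\}}$ is the restriction to $\{a\}$. A single-coalition-first action model is $M=(ST,AC,suc,\{out_a\}_{a\in AG},L)$ with $ST,AC$ nonempty, $suc:ST\to\mathcal P(ST)$, $out_a:ST\times JA_{\{a\}}\to\mathcal P(ST)$ with $\bigcup\{out_a(s,\sigma_a)\mid\sigma_a\in JA_{\{a\}}\}=suc(s)$ for all $s$, and $L:ST\to\mathcal P(AP)$. It determines $out_\emptyset(s,\emptyset)=suc(s)$, $out_C(s,\sigma_C)=\bigcap\{out_a(s,\sigma_C|_{\{a\}})\mid a\in C\}$ for nonempty $C$, $av_C(s)=\{\sigma_C\mid out_C(s,\sigma_C)\neq\emptyset\}$, and the actual effectivity functions $AE_C(s)=\{out_C(s,\sigma_C)\mid\sigma_C\in av_C(s)\}$. A single-coalition-first neighborhood model is $N=(ST,suc,\{nei_a\}_{a\in AG},L)$ with $suc:ST\to\mathcal P(ST)$, $L:ST\to\mathcal P(AP)$, and for all $a,s$, $nei_a(s)\subseteq\mathcal P(ST)$ a cover of $suc(s)$ (union is $suc(s)$ and $\emptyset\notin nei_a(s)$). For families of nonempty sets, $\Delta_1\odot\Delta_2=\{Y_1\cap Y_2\mid Y_1\in\Delta_1,Y_2\in\Delta_2,Y_1\cap Y_2\neq\emptyset\}$,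 extended to finitely many families ($\bigodot\{\Delta\}=\Delta$). Its neighborhood functions: $nei_C(s)=\emptyset$ if $suc(s)=\emptyset$; $\{suc(s)\}$ if $suc(s)\neq\emptyset$ and $C=\emptyset$; $\bigodot\{nei_a(s)\mid a\in C\}$ otherwise. $M$ is $z$-representable by $N$ if they have the same state set $ST$ and labeling $L$ and $AE_C=nei_C$ for every $C\subseteq AG$. -}

module Defs where

open import Level using (0ℓ)
open import Data.Nat using (ℕ)
open import Data.Fin using (Fin)
open import Data.Fin.Subset using (Subset; _∈_; Nonempty)
open import Data.Fin.Subset.Properties using (nonempty?)
open import Data.Product using (Σ; ∃; _×_; _,_)
open import Data.Unit using (⊤)
open import Relation.Nullary using (Dec; yes; no)
open import Relation.Unary using (Pred; Satisfiable)
open import Function.Bundles using (_⇔_)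

_≐_ : {X : Set} → Pred X 0ℓ → Pred X 0ℓ → Set
P ≐ Q = ∀ x → P x ⇔ Q x

-- A family of subsets of X (an element of P(P(X))), given as an indexed family.
record Family (X : Set) : Set₁ where
  constructor fam
  field
    Idx : Set
    mem : Idx → Pred X 0ℓ
open Family public

-- Equality of families of sets (as sets of sets, extensionally):
-- every member of one is (extensionally) equal to some member of the other.
_≈F_ : {X : Set} → Family X → Family X → Set
F ≈F G = (∀ i → ∃ λ j → mem F i ≐ mem G j) × (∀ j → ∃ λ i → mem F i ≐ mem G j)

IsCover : {X : Set} → Family X → Pred X 0ℓ → Set
IsCover F S = (∀ x → S x ⇔ (∃ λ i → mem F i x)) × (∀ i → Satisfiable (mem F i))

-- Agents: AG = Fin n (with n ≥ 1 imposed in the theorem). Coalitions: Subset n.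
-- Joint actions of coalition C: functions C → AC.
JA : {n : ℕ} → Set → Subset n → Set
JA {n} AC C = (a : Fin n) → a ∈ C → AC

-- Single-coalition-first action model.  JA_{a} is identified with AC.
record ActionModel (n : ℕ) (AP : Set) : Set₁ where
  field
    ST     : Set
    AC     : Set
    st₀    : ST
    ac₀    : AC
    sucr   : ST → Pred ST 0ℓ
    out    : Fin n → ST → AC → Pred ST 0ℓ
    outCov : ∀ (a : Fin n) (s : ST) → (λ t → ∃ λ σ → out a s σ t) ≐ sucr s
    L      : ST → Pred AP 0ℓ

module _ {n : ℕ} {AP : Set} (M : ActionModel n AP) where
  open ActionModel M

  outCᵈ : (C : Subset n) → Dec (Nonempty C) → ST → JA AC C → Pred ST 0ℓ
  outCᵈ C (no _)  s σ = sucr s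
  outCᵈ C (yes _) s σ = λ t → ∀ (a : Fin n) (p : a ∈ C) → out a s (σ a p) t

  outC : (C : Subset n) → ST → JA AC C → Pred ST 0ℓ
  outC C = outCᵈ C (nonempty? C)

  av : (C : Subset n) → ST → JA AC C → Set
  av C s σ = Satisfiable (outC C s σ)

  AE : (C : Subset n) → ST → Family ST
  AE C s = fam (Σ (JA AC C) (av C s)) (λ { (σ , _) → outC C s σ })

record NbhdModel (n : ℕ) (AP : Set) (ST : Set) : Set₁ where
  field
    sucr   : ST → Pred ST 0ℓ
    nei    : Fin n → ST → Family ST
    neiCov : ∀ (a : Fin n) (s : ST) → IsCover (nei a s) (sucr s)
    L      : ST → Pred AP 0ℓ

bigOdot : {n : ℕ} {X : Set} (C : Subset n) → (Fin n → Family X) → Family X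
bigOdot {n} {X} C Δ =
  fam (Σ ((a : Fin n) → a ∈ C → Idx (Δ a))
         (λ ch → Satisfiable (λ x → ∀ (a : Fin n) (p : a ∈ C) → mem (Δ a) (ch a p) x)))
      (λ { (ch , _) x → ∀ (a : Fin n) (p : a ∈ C) → mem (Δ a) (ch a p) x })

module _ {n : ℕ} {AP ST : Set} (N : NbhdModel n AP ST) where
  open NbhdModel N

  -- nei_C(s): ∅ if suc(s) = ∅; {suc(s)} if suc(s) ≠ ∅ and C = ∅; ⊙{nei_a(s) | a ∈ C} otherwise.
  neiCᵈ : (C : Subset n) → Dec (Nonempty C) → ST → Family ST
  neiCᵈ C (no _)  s = fam (Satisfiable (sucr s)) (λ _ → sucr s)
  neiCᵈ C (yes _) s =
    fam (Satisfiable (sucr s) × Idx (bigOdot C (λ a → nei a s)))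
        (λ { (_ , i) → mem (bigOdot C (λ a → nei a s)) i })

  neiC : (C : Subset n) → ST → Family ST
  neiC C = neiCᵈ C (nonempty? C)

-- M is z-representable by N (same state set is enforced by the type of N).
ZRepresentable : {n : ℕ} {AP : Set} (M : ActionModel n AP) →
                 NbhdModel n AP (ActionModel.ST M) → Set₁
ZRepresentable M N =
  (NbhdModel.L N ≡ ActionModel.L M) × (∀ C s → AE M C s ≈F neiC N C s)
  where open import Relation.Binary.PropositionalEquality using (_≡_)

{-# OPTIONS --safe #-}
module Submission where

open import Defs
open import Data.Nat using (ℕ; suc)
open import Data.Empty using (⊥-elim)
open import Data.Fin using (Fin)
open import Data.Fin.Subset using (Subset; _∈_; Nonempty)
open import Data.Fin.Subset.Properties using (nonempty?)
open import Data.Product using (Σ; ∃; _,_; proj₁; proj₂)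
open import Function using (id)
open import Function.Bundles using (_↣_; _⇔_; mk⇔; Equivalence)
open import Level using (0ℓ)
open import Relation.Nullary using (Dec; yes; no)
open import Relation.Unary using (Pred; Satisfiable)
open import Relation.Binary.PropositionalEquality using (refl)

-- The neighbourhoods of agent a at s are the nonempty outcome sets out_a(s, σ); for a
-- coalition, choosing one such set per member and intersecting is the same as choosing a
-- joint action and taking its outcome, and a nonempty intersection lies inside suc(s).

≐-refl : {X : Set} {P : Pred X 0ℓ} → P ≐ P
≐-refl _ = mk⇔ id id

module _ {n : ℕ} {AP : Set} (M : ActionModel n AP) where
  open ActionModel M

  out⊆sucr : ∀ a s σ {t} → out a s σ t → sucr s t
  out⊆sucr a s σ {t} o = Equivalence.to (outCov a s t) (σ , o)

  outNbhd : Fin n → ST → Family ST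
  outNbhd a s = fam (Σ AC λ σ → Satisfiable (out a s σ)) (λ (σ , _) → out a s σ)

  outNbhd-isCover : ∀ a s → IsCover (outNbhd a s) (sucr s)
  outNbhd-isCover a s = covers , proj₂
    where
    covers : ∀ t → sucr s t ⇔ ∃ λ i → mem (outNbhd a s) i t
    covers t = mk⇔ (λ st → let (σ , o) = from st in (σ , t , o) , o)
                   (λ ((σ , _) , o) → out⊆sucr a s σ o)
      where open Equivalence (outCov a s t)

  toNbhdModel : NbhdModel n AP ST
  toNbhdModel = record { sucr = sucr ; nei = outNbhd ; neiCov = outNbhd-isCover ; L = L }

  AEᵈ : (C : Subset n) → Dec (Nonempty C) → ST → Family ST
  AEᵈ C d s = fam (Σ (JA AC C) λ σ → Satisfiable (outCᵈ M C d s σ)) (λ (σ , _) → outCᵈ M C d s σ)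

  AEᵈ≈neiCᵈ : ∀ C d s → AEᵈ C d s ≈F neiCᵈ toNbhdModel C d s
  AEᵈ≈neiCᵈ C (no C-empty) s =
      (λ (_ , sucr-inhabited) → sucr-inhabited , ≐-refl)
    , (λ sucr-inhabited → (emptyAction , sucr-inhabited) , ≐-refl)
    where
    emptyAction : JA AC C
    emptyAction a a∈C = ⊥-elim (C-empty (a , a∈C))
  AEᵈ≈neiCᵈ C (yes (a₀ , a₀∈C)) s =
      (λ (σ , t , t∈out) →
         ( (t , out⊆sucr a₀ s (σ a₀ a₀∈C) (t∈out a₀ a₀∈C))
         , (λ a a∈C → σ a a∈C , t , t∈out a a∈C) , t , t∈out)
         , ≐-refl)
    , (λ (_ , choice , t∈⋂) → ((λ a a∈C → proj₁ (choice a a∈C)) , t∈⋂) , ≐-refl)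

representable : {n : ℕ} {AP : Set} (M : ActionModel n AP) →
                Σ (NbhdModel n AP (ActionModel.ST M)) (ZRepresentable M)
representable M = toNbhdModel M , refl , λ C s → AEᵈ≈neiCᵈ M C (nonempty? C) s

theorem4p11 : (n : ℕ) (AP : Set) → AP ↣ ℕ → (M : ActionModel (suc n) AP) →
    Σ (NbhdModel (suc n) AP (ActionModel.ST M)) (λ N → ZRepresentable M N)
theorem4p11 n AP _ M = representable M
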